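{- Let $n\geq 10$, $\ell=n+20$, $m=\lfloor n^2/100\rfloor$, and let $\mathcal H(n)$ be the $6$-uniform hypergraph on vertex set $X\cup Z\cup Y\cup W$, where $X=\{x_0,\dots,x_{n-1}\}$, $Y=\{y_0,\dots,y_{n-1}\}$, $Z=\{z_0,\dots,z_{\ell-1}\}$, $W=\{w_0,\dots,w_{\ell-1}\}$ are pairwise disjoint, with edges $e_t=\{x_{t \bmod n}, x_{t+1\bmod n}, y_{t+1\bmod n}, z_{t\bmod \ell}, z_{t+1\bmod \ell}, w_{t+1\bmod \ell}\}$ for $0\leq t\leq m-1$. For $0\leq t\leq m-1$ let $f_t=\{x_{t+1\bmod n}, z_{t+1\bmod \ell}\}$. Then: (a) $\mathcal H(n)$ has $4n+40$ vertices; (b) if $0\leq t\neq j\leq m-1$ then $e_t\neq e_j$, so $\mathcal H(n)$ has $m$ distinct edges; (c) for $0\leq t,j\leq m-1$, $f_t\subseteq e_j$ if and only if either $t<m-1$ and $j\in\{t,t+1\}$, or $t=m-1=j$. -}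

module Defs where

open import Data.Nat using (ℕ; suc; _+_; _*_; _/_; NonZero)
open import Data.Nat.DivMod using (_mod_)
open import Data.Fin using (Fin)
open import Data.List using (List; []; _∷_)
open import Data.List.Relation.Binary.Subset.Propositional using (_⊆_)
open import Data.Product using (_×_)

-- ℓ = n + 20 (written 20 + n so that it is definitionally a successor)
ℓ : ℕ → ℕ
ℓ n = 20 + n

m : ℕ → ℕ
m n = (n * n) / 100

data Vertex (n : ℕ) : Set where
  x : Fin n → Vertex n
  y : Fin n → Vertex n
  z : Fin (ℓ n) → Vertex n
  w : Fin (ℓ n) → Vertex n

module _ (n : ℕ) .{{_ : NonZero n}} where

  -- the edge e_t (as a list of its vertices; regarded as a set)
  e : ℕ → List (Vertex n)
  e t = x (t mod n) ∷ x (suc t mod n) ∷ y (suc t mod n)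
      ∷ z (t mod ℓ n) ∷ z (suc t mod ℓ n) ∷ w (suc t mod ℓ n) ∷ []

  f : ℕ → List (Vertex n)
  f t = x (suc t mod n) ∷ z (suc t mod ℓ n) ∷ []

_≐_ : {A : Set} → List A → List A → Set
xs ≐ ys = (xs ⊆ ys) × (ys ⊆ xs)

-- An edge e_t is pinned down by the residues of t modulo n and modulo ℓ = n + 20: its x-part
-- gives t mod n, its z-part t mod ℓ. For indices below m ≤ n²/100 these two residues determine
-- t, and they also cannot be shifted against each other by one, because a multiple k n of n
-- lies 20 k below the multiple k ℓ of ℓ, and 20 k is small compared with both moduli.
-- Both parts (b) and (c) reduce to these two facts about the residue map.
module Submission where

open import Data.Empty using (⊥; ⊥-elim)
open import Data.Fin using (Fin; toℕ)
open import Data.Fin.Properties using (toℕ-fromℕ<; +↔⊎)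
open import Data.List.Membership.Propositional using (_∈_)
open import Data.List.Relation.Binary.Subset.Propositional using (_⊆_)
open import Data.List.Relation.Unary.Any using (here; there)
open import Data.Nat
open import Data.Nat.DivMod
open import Data.Nat.Divisibility
open import Data.Nat.Properties
open import Data.Nat.Tactic.RingSolver using (solve-∀)
open import Data.Product using (_×_; _,_)
open import Data.Sum using (_⊎_; inj₁; inj₂)
open import Data.Sum.Function.Propositional using (_⊎-↔_)
open import Function.Bundles using (_↔_; _⇔_; mk⇔; mk↔ₛ′)
open import Function.Properties.Equivalence using () renaming (trans to ⇔-trans)
open import Function.Properties.Inverse using (↔-refl; ↔-sym; ↔-trans)
open import Relation.Nullary using (¬_)
open import Relation.Binary.PropositionalEquality

open import Defs

%≡%⇒∣∸ : ∀ a b p .{{_ : NonZero p}} → a % p ≡ b % p → p ∣ a ∸ b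
%≡%⇒∣∸ a b p a≡b = divides (a / p ∸ b / p) (begin
  a ∸ b                                     ≡⟨ cong₂ _∸_ (m≡m%n+[m/n]*n a p) (m≡m%n+[m/n]*n b p) ⟩
  (a % p + a / p * p) ∸ (b % p + b / p * p) ≡⟨ cong (λ r → _ ∸ (r + b / p * p)) a≡b ⟨
  (a % p + a / p * p) ∸ (a % p + b / p * p) ≡⟨ [m+n]∸[m+o]≡n∸o (a % p) _ _ ⟩
  a / p * p ∸ b / p * p                     ≡⟨ *-distribʳ-∸ p (a / p) (b / p) ⟨
  (a / p ∸ b / p) * p                       ∎)
  where open ≡-Reasoning

%-suc-cong : ∀ a b p .{{_ : NonZero p}} → a % p ≡ b % p → suc a % p ≡ suc b % p
%-suc-cong a b p a≡b = begin
  (1 + a) % p         ≡⟨ %-distribˡ-+ 1 a p ⟩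
  (1 % p + a % p) % p ≡⟨ cong (λ r → (1 % p + r) % p) a≡b ⟩
  (1 % p + b % p) % p ≡⟨ %-distribˡ-+ 1 b p ⟨
  (1 + b) % p         ∎
  where open ≡-Reasoning

%≢%[r+] : ∀ r a p .{{_ : NonZero p}} .{{_ : NonZero r}} → r < p → a % p ≢ (r + a) % p
%≢%[r+] r a p r<p a≡r+a = >⇒∤ r<p (subst (p ∣_) (m+n∸n≡m r a) (%≡%⇒∣∸ (r + a) a p (sym a≡r+a)))

OnOrNext : (p : ℕ) .{{_ : NonZero p}} → ℕ → ℕ → Set
OnOrNext p a b = a % p ≡ b % p ⊎ a % p ≡ suc b % p

OnOrNext-antisym : ∀ {p a b} .{{_ : NonZero p}} → 3 ≤ p →
                   OnOrNext p a b → OnOrNext p b a → a % p ≡ b % p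
OnOrNext-antisym _ (inj₁ a≡b) _ = a≡b
OnOrNext-antisym {p} {b = b} 3≤p (inj₂ a≡b+1) (inj₁ b≡a) =
  ⊥-elim (%≢%[r+] 1 b p (≤-trans (s≤s (s≤s z≤n)) 3≤p) (trans b≡a a≡b+1))
OnOrNext-antisym {p} {a} {b} 3≤p (inj₂ a≡b+1) (inj₂ b≡a+1) =
  ⊥-elim (%≢%[r+] 2 b p 3≤p (trans b≡a+1 (%-suc-cong a (suc b) p a≡b+1)))

NoCommonMultipleUpTo : ℕ → ℕ → ℕ → Set
NoCommonMultipleUpTo p q N = ∀ {d} → d ≤ N → p ∣ d → q ∣ d → d ≡ 0

NoAdjacentMultiplesUpTo : ℕ → ℕ → ℕ → Set
NoAdjacentMultiplesUpTo p q N = ∀ {d} → d ≤ N → p ∣ d → q ∣ suc d → ⊥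

module _ {p q N : ℕ} .{{_ : NonZero p}} .{{_ : NonZero q}} where

  residues-injective : NoCommonMultipleUpTo p q N → ∀ {a b} → a ≤ N → b ≤ N →
                       a % p ≡ b % p → a % q ≡ b % q → a ≡ b
  residues-injective noCommon a≤N b≤N ≡p ≡q =
    ≤-antisym (≥-by-residues a≤N (sym ≡p) (sym ≡q)) (≥-by-residues b≤N ≡p ≡q)
    where
    ≥-by-residues : ∀ {a b} → b ≤ N → a % p ≡ b % p → a % q ≡ b % q → b ≤ a
    ≥-by-residues {a} {b} b≤N ≡p ≡q = m∸n≡0⇒m≤n
      (noCommon (≤-trans (m∸n≤m b a) b≤N) (%≡%⇒∣∸ b a p (sym ≡p)) (%≡%⇒∣∸ b a q (sym ≡q)))

  residues-unshifted : NoAdjacentMultiplesUpTo p q N → NoAdjacentMultiplesUpTo q p N →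
                       ∀ {a b} → a ≤ N → b ≤ N → a % p ≡ b % p → a % q ≢ suc b % q
  residues-unshifted p-then-q q-then-p {a} {b} a≤N b≤N ≡p ≡q with ≤-<-connex a b
  ... | inj₁ a≤b = p-then-q (≤-trans (m∸n≤m b a) b≤N) (%≡%⇒∣∸ b a p (sym ≡p))
                     (subst (q ∣_) (+-∸-assoc 1 a≤b) (%≡%⇒∣∸ (suc b) a q (sym ≡q)))
  residues-unshifted p-then-q q-then-p {suc a} {b} a≤N b≤N ≡p ≡q | inj₂ (s≤s b≤a) =
    q-then-p (≤-trans (m∸n≤m a b) (≤-trans (n≤1+n a) a≤N)) (%≡%⇒∣∸ (suc a) (suc b) q ≡q)
      (subst (p ∣_) (+-∸-assoc 1 b≤a) (%≡%⇒∣∸ (suc a) b p ≡p))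

≡t⊎≡suc-t⇔bounded-cases : ∀ {t j M} → t < M → j < M →
  (j ≡ t ⊎ j ≡ suc t) ⇔ ((t < M ∸ 1 × (j ≡ t ⊎ j ≡ suc t)) ⊎ (t ≡ M ∸ 1 × j ≡ t))
≡t⊎≡suc-t⇔bounded-cases {t} {j} {suc M} (s≤s t≤M) j<M = mk⇔ to from
  where
  to : j ≡ t ⊎ j ≡ suc t → (t < M × (j ≡ t ⊎ j ≡ suc t)) ⊎ (t ≡ M × j ≡ t)
  to (inj₁ refl) with m≤n⇒m<n∨m≡n t≤M
  ... | inj₁ t<M = inj₁ (t<M , inj₁ refl)
  ... | inj₂ t≡M = inj₂ (t≡M , refl)
  to (inj₂ refl) = inj₁ (s≤s⁻¹ j<M , inj₂ refl)
  from : (t < M × (j ≡ t ⊎ j ≡ suc t)) ⊎ (t ≡ M × j ≡ t) → j ≡ t ⊎ j ≡ suc t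
  from (inj₁ (_ , j≡t⊎j≡suc-t)) = j≡t⊎j≡suc-t
  from (inj₂ (_ , j≡t)) = inj₁ j≡t

Vertex↔Fin : ∀ n → Vertex n ↔ Fin (4 * n + 40)
Vertex↔Fin n = subst (λ k → Vertex n ↔ Fin k) (count n) (↔-trans Vertex↔⊎ (↔-sym Fin↔⊎))
  where
  Parts : Set
  Parts = Fin n ⊎ (Fin n ⊎ (Fin (ℓ n) ⊎ Fin (ℓ n)))

  Vertex↔⊎ : Vertex n ↔ Parts
  Vertex↔⊎ = mk↔ₛ′ to from to∘from from∘to
    where
    to : Vertex n → Parts
    to (x i) = inj₁ i
    to (y i) = inj₂ (inj₁ i)
    to (z i) = inj₂ (inj₂ (inj₁ i))
    to (w i) = inj₂ (inj₂ (inj₂ i))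
    from : Parts → Vertex n
    from (inj₁ i) = x i
    from (inj₂ (inj₁ i)) = y i
    from (inj₂ (inj₂ (inj₁ i))) = z i
    from (inj₂ (inj₂ (inj₂ i))) = w i
    to∘from : ∀ s → to (from s) ≡ s
    to∘from (inj₁ _) = refl
    to∘from (inj₂ (inj₁ _)) = refl
    to∘from (inj₂ (inj₂ (inj₁ _))) = refl
    to∘from (inj₂ (inj₂ (inj₂ _))) = refl
    from∘to : ∀ v → from (to v) ≡ v
    from∘to (x _) = refl
    from∘to (y _) = refl
    from∘to (z _) = refl
    from∘to (w _) = refl

  Fin↔⊎ : Fin (n + (n + (ℓ n + ℓ n))) ↔ Parts
  Fin↔⊎ = ↔-trans +↔⊎ (↔-refl ⊎-↔ ↔-trans +↔⊎ (↔-refl ⊎-↔ +↔⊎))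

  count : ∀ k → k + (k + ((20 + k) + (20 + k))) ≡ 4 * k + 40
  count = solve-∀

mod≡mod⇒%≡% : ∀ {a b p} .{{_ : NonZero p}} → a mod p ≡ b mod p → a % p ≡ b % p
mod≡mod⇒%≡% {a} {b} {p} a≡b =
  trans (sym (toℕ-fromℕ< (m%n<n a p))) (trans (cong toℕ a≡b) (toℕ-fromℕ< (m%n<n b p)))

module _ (n : ℕ) .{{_ : NonZero n}} where

  x-injective : ∀ {i j : Fin n} → x {n} i ≡ x j → i ≡ j
  x-injective refl = refl

  z-injective : ∀ {i j : Fin (ℓ n)} → z {n} i ≡ z j → i ≡ j
  z-injective refl = refl

  x∈e⇒OnOrNext : ∀ a j → x (a mod n) ∈ e n j → OnOrNext n a j
  x∈e⇒OnOrNext a j (here eq) = inj₁ (mod≡mod⇒%≡% {a} {j} (x-injective eq))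
  x∈e⇒OnOrNext a j (there (here eq)) = inj₂ (mod≡mod⇒%≡% {a} {suc j} (x-injective eq))
  x∈e⇒OnOrNext a j (there (there (here ())))
  x∈e⇒OnOrNext a j (there (there (there (here ()))))
  x∈e⇒OnOrNext a j (there (there (there (there (here ())))))
  x∈e⇒OnOrNext a j (there (there (there (there (there (here ()))))))
  x∈e⇒OnOrNext a j (there (there (there (there (there (there ()))))))

  z∈e⇒OnOrNext : ∀ a j → z (a mod ℓ n) ∈ e n j → OnOrNext (ℓ n) a j
  z∈e⇒OnOrNext a j (here ())
  z∈e⇒OnOrNext a j (there (here ()))
  z∈e⇒OnOrNext a j (there (there (here ())))
  z∈e⇒OnOrNext a j (there (there (there (here eq)))) =
    inj₁ (mod≡mod⇒%≡% {a} {j} (z-injective eq))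
  z∈e⇒OnOrNext a j (there (there (there (there (here eq))))) =
    inj₂ (mod≡mod⇒%≡% {a} {suc j} (z-injective eq))
  z∈e⇒OnOrNext a j (there (there (there (there (there (here ()))))))
  z∈e⇒OnOrNext a j (there (there (there (there (there (there ()))))))

  f⊆e⇐ : ∀ {t j} → j ≡ t ⊎ j ≡ suc t → f n t ⊆ e n j
  f⊆e⇐ (inj₁ refl) (here refl) = there (here refl)
  f⊆e⇐ (inj₁ refl) (there (here refl)) = there (there (there (there (here refl))))
  f⊆e⇐ (inj₂ refl) (here refl) = here refl
  f⊆e⇐ (inj₂ refl) (there (here refl)) = there (there (there (here refl)))

  ≤m⇒*100≤n*n : ∀ {d} → d ≤ m n → d * 100 ≤ n * n
  ≤m⇒*100≤n*n d≤m = ≤-trans (*-monoˡ-≤ 100 d≤m) (m/n*n≤m (n * n) 100)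

  k*n≤m⇒k*100≤n : ∀ k → k * n ≤ m n → k * 100 ≤ n
  k*n≤m⇒k*100≤n k k*n≤m = *-cancelʳ-≤ (k * 100) n n (begin
    k * 100 * n   ≡⟨ *-assoc k 100 n ⟩
    k * (100 * n) ≡⟨ cong (k *_) (*-comm 100 n) ⟩
    k * (n * 100) ≡⟨ *-assoc k n 100 ⟨
    k * n * 100   ≤⟨ ≤m⇒*100≤n*n k*n≤m ⟩
    n * n         ∎)
    where open ≤-Reasoning

  k*ℓ≤m⇒k*100<n : ∀ k → k * ℓ n ≤ m n → k * 100 < n
  k*ℓ≤m⇒k*100<n k k*ℓ≤m = *-cancelʳ-< (ℓ n) (k * 100) n (begin-strict
    k * 100 * ℓ n   ≡⟨ *-assoc k 100 (ℓ n) ⟩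
    k * (100 * ℓ n) ≡⟨ cong (k *_) (*-comm 100 (ℓ n)) ⟩
    k * (ℓ n * 100) ≡⟨ *-assoc k (ℓ n) 100 ⟨
    k * ℓ n * 100   ≤⟨ ≤m⇒*100≤n*n k*ℓ≤m ⟩
    n * n           <⟨ *-monoʳ-< n (m<n+m n {20} z<s) ⟩
    n * ℓ n         ∎)
    where open ≤-Reasoning

  -- In each case below the two multiples differ by a positive number smaller than the modulus.
  n-ℓ-noCommonMultiple : NoCommonMultipleUpTo n (ℓ n) (m n)
  n-ℓ-noCommonMultiple _ (divides-refl zero) _ = refl
  n-ℓ-noCommonMultiple d≤m (divides-refl (suc k)) ℓ∣d =
    ⊥-elim (>⇒∤ gap<ℓ (∣m+n∣m⇒∣n (subst (ℓ n ∣_) (split k n) (n∣m*n (suc k))) ℓ∣d))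
    where
    split : ∀ k n → suc k * (20 + n) ≡ suc k * n + suc k * 20
    split = solve-∀
    gap<ℓ : suc k * 20 < ℓ n
    gap<ℓ = ≤-<-trans
      (≤-trans (*-monoʳ-≤ (suc k) (m≤m+n 20 80)) (k*n≤m⇒k*100≤n (suc k) d≤m))
      (m<n+m n {20} z<s)

  n-then-ℓ : NoAdjacentMultiplesUpTo n (ℓ n) (m n)
  n-then-ℓ _ (divides-refl zero) ℓ∣1 = >⇒∤ (s≤s (s≤s z≤n)) ℓ∣1
  n-then-ℓ d≤m (divides-refl (suc k)) ℓ∣d+1 =
    >⇒∤ gap<ℓ (∣m+n∣m⇒∣n (subst (ℓ n ∣_) (split k n) (n∣m*n (suc k))) ℓ∣d+1)
    where
    split : ∀ k n → suc k * (20 + n) ≡ suc (suc k * n) + (19 + k * 20)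
    split = solve-∀
    gap<ℓ : 19 + k * 20 < ℓ n
    gap<ℓ = s≤s (+-monoʳ-≤ 19 (≤-trans (*-monoʳ-≤ k (m≤m+n 20 80))
                  (≤-trans (m≤n+m (k * 100) 100) (k*n≤m⇒k*100≤n (suc k) d≤m))))

  ℓ-then-n : 10 ≤ n → NoAdjacentMultiplesUpTo (ℓ n) n (m n)
  ℓ-then-n 10≤n d≤m (divides-refl k) n∣d+1 =
    >⇒∤ (gap<n k (k*ℓ≤m⇒k*100<n k d≤m))
        (∣m+n∣m⇒∣n (subst (n ∣_) (split k n) n∣d+1) (n∣m*n k))
    where
    split : ∀ k n → suc (k * (20 + n)) ≡ k * n + suc (k * 20)
    split = solve-∀
    gap<n : ∀ k → k * 100 < n → suc (k * 20) < n
    gap<n zero _ = ≤-trans (s≤s (s≤s z≤n)) 10≤n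
    gap<n (suc k) k*100<n = ≤-<-trans (*-monoʳ-< (suc k) (m≤m+n 21 79)) k*100<n

module Hypergraph (n : ℕ) .{{_ : NonZero n}} (10≤n : 10 ≤ n) where

  residues-≡ : ∀ {a b} → a ≤ m n → b ≤ m n → a % n ≡ b % n → a % ℓ n ≡ b % ℓ n → a ≡ b
  residues-≡ = residues-injective (n-ℓ-noCommonMultiple n)

  e-injective : ∀ {t j} → t < m n → j < m n → e n t ≐ e n j → t ≡ j
  e-injective {t} {j} t<m j<m (t⊆j , j⊆t) = residues-≡ (<⇒≤ t<m) (<⇒≤ j<m) ≡n ≡ℓ
    where
    3≤n : 3 ≤ n
    3≤n = ≤-trans (s≤s (s≤s (s≤s z≤n))) 10≤n
    3≤ℓ : 3 ≤ ℓ n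
    3≤ℓ = s≤s (s≤s (s≤s z≤n))
    x∈e : ∀ {i} → x (i mod n) ∈ e n i
    x∈e = here refl
    z∈e : ∀ {i} → z (i mod ℓ n) ∈ e n i
    z∈e = there (there (there (here refl)))
    ≡n : t % n ≡ j % n
    ≡n = OnOrNext-antisym 3≤n (x∈e⇒OnOrNext n t j (t⊆j x∈e)) (x∈e⇒OnOrNext n j t (j⊆t x∈e))
    ≡ℓ : t % ℓ n ≡ j % ℓ n
    ≡ℓ = OnOrNext-antisym {a = t} {j} 3≤ℓ (z∈e⇒OnOrNext n t j (t⊆j z∈e)) (z∈e⇒OnOrNext n j t (j⊆t z∈e))

  f⊆e⇒ : ∀ {t j} → t < m n → j < m n → f n t ⊆ e n j → j ≡ t ⊎ j ≡ suc t
  f⊆e⇒ {t} {j} t<m j<m f⊆e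
    with x∈e⇒OnOrNext n (suc t) j (f⊆e (here refl))
       | z∈e⇒OnOrNext n (suc t) j (f⊆e (there (here refl)))
  ... | inj₁ ≡n | inj₁ ≡ℓ = inj₂ (sym (residues-≡ t<m (<⇒≤ j<m) ≡n ≡ℓ))
  ... | inj₂ ≡n | inj₂ ≡ℓ = inj₁ (sym (suc-injective (residues-≡ t<m j<m ≡n ≡ℓ)))
  ... | inj₁ ≡n | inj₂ ≡ℓ =
    ⊥-elim (residues-unshifted (n-then-ℓ n) (ℓ-then-n n 10≤n) t<m (<⇒≤ j<m) ≡n ≡ℓ)
  ... | inj₂ ≡n | inj₁ ≡ℓ =
    ⊥-elim (residues-unshifted (ℓ-then-n n 10≤n) (n-then-ℓ n) t<m (<⇒≤ j<m) ≡ℓ ≡n)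

  f⊆e⇔ : ∀ {t j} → t < m n → j < m n → f n t ⊆ e n j ⇔ (j ≡ t ⊎ j ≡ suc t)
  f⊆e⇔ t<m j<m = mk⇔ (f⊆e⇒ t<m j<m) (f⊆e⇐ n)

mainTheorem7 : (n : ℕ) .{{_ : NonZero n}} → 10 ≤ n →
      (Vertex n ↔ Fin (4 * n + 40))
    × (∀ t j → t < m n → j < m n → t ≢ j → ¬ (e n t ≐ e n j))
    × (∀ t j → t < m n → j < m n →
         (f n t ⊆ e n j ⇔ ((t < m n ∸ 1 × (j ≡ t ⊎ j ≡ suc t)) ⊎ (t ≡ m n ∸ 1 × j ≡ t))))
mainTheorem7 n 10≤n =
    Vertex↔Fin n
  , (λ t j t<m j<m t≢j e≐e → t≢j (e-injective t<m j<m e≐e))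
  , (λ t j t<m j<m → ⇔-trans (f⊆e⇔ t<m j<m) (≡t⊎≡suc-t⇔bounded-cases t<m j<m))
  where open Hypergraph n 10≤n
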